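{- The structures $(\mathbb{N},<,=)$ and $(\mathbb{Z}\setminus\mathbb{N},<,=)$ have the property $\mathsf{EHomDef}(\mathsf{WMSO{+}B})$.
   Context: These are structures over the signature $\{<,=\}$ (both binary) with the usual order and equality restricted to $\mathbb{N}=\{0,1,2,\dots\}$, resp. to the negative integers. For a $\sigma$-structure $\mathcal{B}=(B,J)$ with $\sigma\subseteq\{<,=\}$ and such a structure with domain $C$, a homomorphism is a map $h:B\to C$ with $h(b_1)<h(b_2)$ whenever $(b_1,b_2)\in J(<)$ and $h(b_1)=h(b_2)$ whenever $(b_1,b_2)\in J(=)$ (for the symbols in $\sigma$); $J(=)$ need not be the identity. Write $\mathcal{B}\preceq\mathcal{A}$ if one exists. $\mathsf{WMSO}$ is monadic second-order logic with set variables ranging only over finite sets; $\mathsf{WMSO{+}B}$ adds the bounding quantifier: $\mathcal{A}\models\mathsf{B}X\colon\phi(X)$ iff there is $b\in\mathbb{N}$ with $|F|\le b$ for every finite $F$ with $\mathcal{A}\models\phi(F)$. A structure $\mathcal{A}$ over signature $\mathcal{S}$ has property $\mathsf{EHomDef}(\mathcal{L})$ if there is a computable function mapping each finite $\sigma\subseteq\mathcal{S}$ to an $\mathcal{L}$-sentence $\varphi_\sigma$ over $\sigma$ such that for every countable $\sigma$-structure $\mathcal{B}$: $\mathcal{B}\preceq\mathcal{A}$ iff $\mathcal{B}\models\varphi_\sigma$. -}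

module Defs where

open import Level using (0ℓ)
open import Data.Bool using (Bool; T)
open import Data.Nat as ℕ using (ℕ; suc; _≤_)
open import Data.Integer as ℤ using (ℤ; 0ℤ)
open import Data.Fin using (Fin; zero; suc)
open import Data.List using (List; _∷_; length)
open import Data.List.Membership.Propositional using (_∈_)
open import Data.List.Relation.Unary.Unique.Propositional using (Unique)
open import Data.Product using (Σ; Σ-syntax; _×_; proj₁)
open import Relation.Binary.PropositionalEquality using (_≡_)
open import Relation.Nullary using (¬_)
open import Function.Bundles using (_⇔_)
open import Axiom.ExcludedMiddle using (ExcludedMiddle)

data Sym : Set where
  lt eq : Sym

Sig : Set
Sig = Sym → Bool

-- Countable σ-structures: a carrier with an injection into ℕ, and for every
-- symbol of σ an arbitrary binary relation (J(=) need not be the identity).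
record Structure (σ : Sig) : Set₁ where
  field
    Carrier : Set
    enc     : Carrier → ℕ
    enc-inj : ∀ {x y} → enc x ≡ enc y → x ≡ y
    rel     : (s : Sym) → T (σ s) → Carrier → Carrier → Set
open Structure public

Hom : {σ : Sig} → Structure σ → (D : Set) → (D → D → Set) → (D → D → Set) → Set
Hom {σ} 𝓑 D _≺_ _≈_ =
  Σ[ h ∈ (Carrier 𝓑 → D) ]
    ((∀ (p : T (σ lt)) x y → rel 𝓑 lt p x y → h x ≺ h y) ×
     (∀ (p : T (σ eq)) x y → rel 𝓑 eq p x y → h x ≈ h y))

_⪯ℕ : {σ : Sig} → Structure σ → Set
𝓑 ⪯ℕ = Hom 𝓑 ℕ ℕ._<_ _≡_

Neg : Set
Neg = Σ[ z ∈ ℤ ] (z ℤ.< 0ℤ)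

_⪯Neg : {σ : Sig} → Structure σ → Set
𝓑 ⪯Neg = Hom 𝓑 Neg (λ a b → proj₁ a ℤ.< proj₁ b) (λ a b → proj₁ a ≡ proj₁ b)

-- Syntax of WMSO+B over σ, with de Bruijn indices:
-- n first-order variables and m (finite-)set variables in scope.
data Formula (σ : Sig) (n m : ℕ) : Set where
  atom : (s : Sym) → T (σ s) → Fin n → Fin n → Formula σ n m
  mem  : Fin n → Fin m → Formula σ n m
  neg  : Formula σ n m → Formula σ n m
  and  : Formula σ n m → Formula σ n m → Formula σ n m
  ex₁  : Formula σ (suc n) m → Formula σ n m
  ex₂  : Formula σ n (suc m) → Formula σ n m
  bnd  : Formula σ n (suc m) → Formula σ n m

Sentence : Sig → Set
Sentence σ = Formula σ 0 0

-- Finite subsets of a carrier: duplicate-free lists (so cardinality = length).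
FinSet : Set → Set
FinSet C = Σ[ xs ∈ List C ] Unique xs

_▸_ : ∀ {A : Set} {k} → A → (Fin k → A) → Fin (suc k) → A
(a ▸ ρ) zero    = a
(a ▸ ρ) (suc i) = ρ i

-- Satisfaction (classical reading is imposed via an excluded-middle hypothesis
-- in the statement).
Sat : ∀ {σ n m} (𝓑 : Structure σ) → Formula σ n m →
      (Fin n → Carrier 𝓑) → (Fin m → FinSet (Carrier 𝓑)) → Set
Sat 𝓑 (atom s p i j) ρ ξ = rel 𝓑 s p (ρ i) (ρ j)
Sat 𝓑 (mem i X)      ρ ξ = ρ i ∈ proj₁ (ξ X)
Sat 𝓑 (neg φ)        ρ ξ = ¬ Sat 𝓑 φ ρ ξ
Sat 𝓑 (and φ ψ)      ρ ξ = Sat 𝓑 φ ρ ξ × Sat 𝓑 ψ ρ ξ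
Sat 𝓑 (ex₁ φ)        ρ ξ = Σ[ b ∈ Carrier 𝓑 ] Sat 𝓑 φ (b ▸ ρ) ξ
Sat 𝓑 (ex₂ φ)        ρ ξ = Σ[ F ∈ FinSet (Carrier 𝓑) ] Sat 𝓑 φ ρ (F ▸ ξ)
Sat 𝓑 (bnd φ)        ρ ξ =
  Σ[ b ∈ ℕ ] (∀ (F : FinSet (Carrier 𝓑)) → Sat 𝓑 φ ρ (F ▸ ξ) → length (proj₁ F) ≤ b)

_⊨_ : ∀ {σ} (𝓑 : Structure σ) → Sentence σ → Set
𝓑 ⊨ φ = Sat 𝓑 φ (λ ()) (λ ())

-- The map σ ↦ φ_σ is an Agda function (hence computable) chosen before and
-- independently of the excluded-middle hypothesis used for the classical semantics.
EHomDef-WMSOB : (∀ {σ : Sig} → Structure σ → Set) → Set₁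
EHomDef-WMSOB _⪯A =
  Σ[ φ ∈ ((σ : Sig) → Sentence σ) ]
    (ExcludedMiddle 0ℓ → ∀ (σ : Sig) (𝓑 : Structure σ) → (𝓑 ⪯A) ⇔ (𝓑 ⊨ φ σ))

-- A σ-structure maps homomorphically into (ℕ, <, =) iff, writing u ⇝ v for u < v, u = v or v = u,
-- (i) no ⇝-cycle passes through a <-edge, and (ii) for every x the chains below x (sets linearly
-- ordered by ⇝-reachability through a <-edge, all of whose elements reach x) have bounded size.
-- A homomorphism h forces chains below x to have at most h x + 1 elements; conversely, by (i) and
-- (ii) the length of a longest chain below x is a homomorphism. Both conditions are WMSO+B-definable,
-- since paths live in finite sets P and reachability inside P is membership in every P-closed set.
-- For the negative integers one reverses < in the structure and in the sentence.

module Submission where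

open import Defs
open import Data.Product using (_×_)

open import Level using (0ℓ)
open import Data.Bool using (T)
open import Data.Bool.Properties using (T-irrelevant)
open import Data.Empty using (⊥-elim)
open import Data.Fin using (Fin; zero; suc; fromℕ<)
open import Data.Fin.Properties using (fromℕ<-injective; injective⇒≤)
open import Data.Integer as ℤ using (-[1+_]; +_; -<-; -<+; +<+)
open import Data.Integer.Properties using (-[1+-injective)
open import Data.List using (List; []; _∷_; length; lookup; filter)
open import Data.List.Membership.Propositional using (_∈_; _∉_)
open import Data.List.Membership.Propositional.Properties using (∈-lookup; ∈-filter⁺; ∈-filter⁻)
open import Data.List.Relation.Binary.Subset.Propositional using (_⊆_)
open import Data.List.Relation.Unary.All as All using ()
open import Data.List.Relation.Unary.All.Properties using (¬Any⇒All¬)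
open import Data.List.Relation.Unary.AllPairs using ([]; _∷_)
open import Data.List.Relation.Unary.Any using (here; there)
open import Data.List.Relation.Unary.Unique.Propositional using (Unique)
open import Data.List.Relation.Unary.Unique.Propositional.Properties using (filter⁺)
open import Data.Nat using (ℕ; zero; suc; _≤_; _<_; s≤s)
open import Data.Nat.Properties
  using (≤-refl; ≤-trans; ≤-reflexive; <⇒≤; ≤-<-trans; <-≤-trans; <-irrefl; ≤-antisym; ≤∧≢⇒<; ≤-pred)
open import Data.Product using (Σ; Σ-syntax; _,_; proj₁; proj₂)
open import Data.Product.Function.NonDependent.Propositional using (_×-⇔_)
open import Data.Sum using (_⊎_; inj₁; inj₂)
open import Data.Sum.Function.Propositional using (_⊎-⇔_)
open import Function using (_∘_)
open import Function.Bundles using (_⇔_; mk⇔; Equivalence)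
open import Function.Construct.Identity using (⇔-id)
open import Function.Construct.Symmetry using (⇔-sym)
open import Function.Properties.Equivalence using () renaming (trans to infixr 4 _⟨⇔⟩_)
open import Function.Definitions using (Injective)
open import Function.Related.TypeIsomorphisms using (→-cong-⇔; ¬-cong-⇔)
open import Axiom.ExcludedMiddle using (ExcludedMiddle)
open import Axiom.DoubleNegationElimination using (em⇒dne)
open import Relation.Binary.PropositionalEquality using (_≡_; refl; sym; cong; subst)
open import Relation.Nullary using (¬_; Dec; yes; no)
open import Relation.Nullary.Decidable.Core using (T?)

open Equivalence using (to; from)

∃-cong-⇔ : {C : Set} {A B : C → Set} → (∀ c → A c ⇔ B c) → Σ C A ⇔ Σ C B
∃-cong-⇔ A⇔B = mk⇔ (λ (c , a) → c , to (A⇔B c) a) (λ (c , b) → c , from (A⇔B c) b)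

∀-cong-⇔ : {C : Set} {A B : C → Set} → (∀ c → A c ⇔ B c) → (∀ c → A c) ⇔ (∀ c → B c)
∀-cong-⇔ A⇔B = mk⇔ (λ f c → to (A⇔B c) (f c)) (λ g c → from (A⇔B c) (g c))

module Classical (lem : ExcludedMiddle 0ℓ) where

  ¬×¬-cong-⊎ : {A A′ B B′ : Set} → A ⇔ A′ → B ⇔ B′ → (¬ (¬ A × ¬ B)) ⇔ (A′ ⊎ B′)
  ¬×¬-cong-⊎ {A} {B = B} A⇔A′ B⇔B′ =
    mk⇔ decide (λ { (inj₁ a) (¬a , _) → ¬a a ; (inj₂ b) (_ , ¬b) → ¬b b })
    ⟨⇔⟩ (A⇔A′ ⊎-⇔ B⇔B′)
    where
    decide : ¬ (¬ A × ¬ B) → A ⊎ B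
    decide ¬[¬a×¬b] with lem {A} | lem {B}
    ... | yes a | _     = inj₁ a
    ... | no ¬a | yes b = inj₂ b
    ... | no ¬a | no ¬b = ⊥-elim (¬[¬a×¬b] (¬a , ¬b))

  ¬×¬-cong-→ : {A A′ B B′ : Set} → A ⇔ A′ → B ⇔ B′ → (¬ (A × ¬ B)) ⇔ (A′ → B′)
  ¬×¬-cong-→ A⇔A′ B⇔B′ =
    mk⇔ (λ ¬[a×¬b] a → em⇒dne lem (λ ¬b → ¬[a×¬b] (a , ¬b))) (λ a→b (a , ¬b) → ¬b (a→b a))
    ⟨⇔⟩ →-cong-⇔ A⇔A′ B⇔B′

  ¬∃¬-cong-∀ : {C : Set} {A B : C → Set} → (∀ c → A c ⇔ B c) → (¬ Σ C (¬_ ∘ A)) ⇔ (∀ c → B c)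
  ¬∃¬-cong-∀ A⇔B =
    mk⇔ (λ ¬∃¬ c → em⇒dne lem (λ ¬a → ¬∃¬ (c , ¬a))) (λ ∀a (c , ¬a) → ¬a (∀a c))
    ⟨⇔⟩ ∀-cong-⇔ A⇔B

  bounded⇒∃max : (R : ℕ → Set) → R 0 → (b : ℕ) → (∀ k → R k → k ≤ b) →
                 Σ[ m ∈ ℕ ] R m × (∀ k → R k → k ≤ m)
  bounded⇒∃max R r₀ b R≤b with lem {R b}
  ... | yes rb = b , rb , R≤b
  bounded⇒∃max R r₀ zero    R≤b | no ¬rb = ⊥-elim (¬rb r₀)
  bounded⇒∃max R r₀ (suc b) R≤b | no ¬rb = bounded⇒∃max R r₀ b
    (λ k rk → ≤-pred (≤∧≢⇒< (R≤b k rk) (λ k≡1+b → ¬rb (subst R k≡1+b rk))))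

unique-lookup-injective : {A : Set} {xs : List A} → Unique xs → Injective _≡_ _≡_ (lookup xs)
unique-lookup-injective (_ ∷ _)    {zero}  {zero}  _ = refl
unique-lookup-injective (x∉xs ∷ _) {zero}  {suc j} x≡xⱼ =
  ⊥-elim (All.lookup x∉xs (∈-lookup j) x≡xⱼ)
unique-lookup-injective (x∉xs ∷ _) {suc i} {zero}  xᵢ≡x =
  ⊥-elim (All.lookup x∉xs (∈-lookup i) (sym xᵢ≡x))
unique-lookup-injective (_ ∷ u)    {suc i} {suc j} xᵢ≡xⱼ = cong suc (unique-lookup-injective u xᵢ≡xⱼ)

injectiveOn-below⇒length≤ : {A : Set} {xs : List A} (f : A → ℕ) (n : ℕ) → Unique xs →
  (∀ {y z} → y ∈ xs → z ∈ xs → f y ≡ f z → y ≡ z) → (∀ {y} → y ∈ xs → f y < n) → length xs ≤ n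
injectiveOn-below⇒length≤ {xs = xs} f n u f-inj f<n = injective⇒≤ g-injective
  where
  g : Fin (length xs) → Fin n
  g i = fromℕ< (f<n (∈-lookup i))
  g-injective : Injective _≡_ _≡_ g
  g-injective {i} {j} gᵢ≡gⱼ = unique-lookup-injective u
    (f-inj (∈-lookup i) (∈-lookup j) (fromℕ<-injective _ _ (f<n (∈-lookup i)) (f<n (∈-lookup j)) gᵢ≡gⱼ))

module Graph {σ : Sig} (𝓑 : Structure σ) where

  private
    C : Set
    C = Carrier 𝓑

  _⋖_ _≐_ _⇝_ : C → C → Set
  x ⋖ y = Σ[ p ∈ T (σ lt) ] rel 𝓑 lt p x y
  x ≐ y = Σ[ p ∈ T (σ eq) ] rel 𝓑 eq p x y
  x ⇝ y = x ⋖ y ⊎ x ≐ y ⊎ y ≐ x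

  data Path (P : List C) : C → C → Set where
    []  : ∀ {a} → a ∈ P → Path P a a
    _∷_ : ∀ {a b c} → a ∈ P × a ⇝ b → Path P b c → Path P a c

  StrictPath : List C → C → C → Set
  StrictPath P a b = Σ[ u ∈ C ] Σ[ v ∈ C ] Path P a u × u ⋖ v × Path P v b

  Comparable : List C → C → C → Set
  Comparable P y z = StrictPath P y z ⊎ StrictPath P z y ⊎ y ≡ z

  ChainBelow : C → List C → Set
  ChainBelow x F = Σ[ P ∈ FinSet C ]
    (∀ y → y ∈ F → Path (proj₁ P) y x) × (∀ y z → y ∈ F → z ∈ F → Comparable (proj₁ P) y z)

  Acyclic : Set
  Acyclic = ¬ (Σ[ P ∈ FinSet C ] Σ[ y ∈ C ] StrictPath (proj₁ P) y y)

  ChainsBounded : Set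
  ChainsBounded = ∀ x → Σ[ b ∈ ℕ ] (∀ (F : FinSet C) → ChainBelow x (proj₁ F) → length (proj₁ F) ≤ b)

  Closed : List C → List C → Set
  Closed Z P = ∀ u v → u ∈ Z → v ∈ P → u ⇝ v → v ∈ Z

  path-head : ∀ {P a b} → Path P a b → a ∈ P
  path-head ([] a∈P)        = a∈P
  path-head ((a∈P , _) ∷ _) = a∈P

  path-last : ∀ {P a b} → Path P a b → b ∈ P
  path-last ([] b∈P)  = b∈P
  path-last (_ ∷ p)   = path-last p

  _++ᵖ_ : ∀ {P a b c} → Path P a b → Path P b c → Path P a c
  [] _    ++ᵖ q = q
  (e ∷ p) ++ᵖ q = e ∷ (p ++ᵖ q)

  path-∷ʳ : ∀ {P a b c} → Path P a b → b ⇝ c → c ∈ P → Path P a c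
  path-∷ʳ p b⇝c c∈P = p ++ᵖ ((path-last p , b⇝c) ∷ [] c∈P)

  path-⊆ : ∀ {P Q a b} → P ⊆ Q → Path P a b → Path Q a b
  path-⊆ P⊆Q ([] a∈P)         = [] (P⊆Q a∈P)
  path-⊆ P⊆Q ((a∈P , e) ∷ p) = (P⊆Q a∈P , e) ∷ path-⊆ P⊆Q p

  strictPath-⊆ : ∀ {P Q a b} → P ⊆ Q → StrictPath P a b → StrictPath Q a b
  strictPath-⊆ P⊆Q (u , v , p , u⋖v , q) = u , v , path-⊆ P⊆Q p , u⋖v , path-⊆ P⊆Q q

  comparable-⊆ : ∀ {P Q y z} → P ⊆ Q → Comparable P y z → Comparable Q y z
  comparable-⊆ P⊆Q (inj₁ y→z)        = inj₁ (strictPath-⊆ P⊆Q y→z)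
  comparable-⊆ P⊆Q (inj₂ (inj₁ z→y)) = inj₂ (inj₁ (strictPath-⊆ P⊆Q z→y))
  comparable-⊆ P⊆Q (inj₂ (inj₂ y≡z)) = inj₂ (inj₂ y≡z)

  path⇒∈closed : ∀ {P a b} (Z : List C) → Path P a b → a ∈ Z → Closed Z P → b ∈ Z
  path⇒∈closed Z ([] _)           a∈Z closed = a∈Z
  path⇒∈closed Z ((_ , a⇝c) ∷ p) a∈Z closed =
    path⇒∈closed Z p (closed _ _ a∈Z (path-head p) a⇝c) closed

  module _ (hom : 𝓑 ⪯ℕ) where

    private
      h : C → ℕ
      h = proj₁ hom

    ⇝-mono : ∀ {x y} → x ⇝ y → h x ≤ h y
    ⇝-mono (inj₁ (p , r))        = <⇒≤ (proj₁ (proj₂ hom) p _ _ r)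
    ⇝-mono (inj₂ (inj₁ (p , r))) = ≤-reflexive (proj₂ (proj₂ hom) p _ _ r)
    ⇝-mono (inj₂ (inj₂ (p , r))) = ≤-reflexive (sym (proj₂ (proj₂ hom) p _ _ r))

    path-mono : ∀ {P a b} → Path P a b → h a ≤ h b
    path-mono ([] _)         = ≤-refl
    path-mono ((_ , e) ∷ p) = ≤-trans (⇝-mono e) (path-mono p)

    strictPath-mono : ∀ {P a b} → StrictPath P a b → h a < h b
    strictPath-mono (u , v , p , (q , u⋖v) , p′) =
      ≤-<-trans (path-mono p) (<-≤-trans (proj₁ (proj₂ hom) q u v u⋖v) (path-mono p′))

    ⪯ℕ⇒acyclic : Acyclic
    ⪯ℕ⇒acyclic (_ , _ , cycle) = <-irrefl refl (strictPath-mono cycle)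

    -- A chain below x is mapped injectively into {0, …, h x}.
    ⪯ℕ⇒chainsBounded : ChainsBounded
    ⪯ℕ⇒chainsBounded x = suc (h x) , λ (F , F-unique) (P , below , comparable) →
      injectiveOn-below⇒length≤ h (suc (h x)) F-unique
        (λ y∈F z∈F → injective (comparable _ _ y∈F z∈F))
        (λ y∈F → s≤s (path-mono (below _ y∈F)))
      where
      injective : ∀ {Q y z} → Comparable Q y z → h y ≡ h z → y ≡ z
      injective (inj₁ y→z)        hy≡hz = ⊥-elim (<-irrefl hy≡hz (strictPath-mono y→z))
      injective (inj₂ (inj₁ z→y)) hy≡hz = ⊥-elim (<-irrefl (sym hy≡hz) (strictPath-mono z→y))
      injective (inj₂ (inj₂ y≡z)) _     = y≡z

module Rank (lem : ExcludedMiddle 0ℓ) {σ : Sig} (𝓑 : Structure σ) where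

  open Graph 𝓑
  open Classical lem

  private
    C : Set
    C = Carrier 𝓑

  insert : C → FinSet C → FinSet C
  insert y (P , P-unique) with lem {y ∈ P}
  ... | yes _   = P , P-unique
  ... | no y∉P = y ∷ P , ¬Any⇒All¬ P y∉P ∷ P-unique

  ∈-insert : ∀ y P → y ∈ proj₁ (insert y P)
  ∈-insert y (P , _) with lem {y ∈ P}
  ... | yes y∈P = y∈P
  ... | no _    = here refl

  ⊆-insert : ∀ y P → proj₁ P ⊆ proj₁ (insert y P)
  ⊆-insert y (P , _) with lem {y ∈ P}
  ... | yes _ = λ z∈P → z∈P
  ... | no _  = there

  HasChainOfLength : C → ℕ → Set
  HasChainOfLength x k = Σ[ F ∈ FinSet C ] ChainBelow x (proj₁ F) × length (proj₁ F) ≡ k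

  emptyChain : ∀ x → HasChainOfLength x 0
  emptyChain x = ([] , []) , (([] , []) , (λ _ ()) , (λ _ _ ())) , refl

  chain-⇝ : ∀ {x y k} → x ⇝ y → HasChainOfLength x k → HasChainOfLength y k
  chain-⇝ {y = y} x⇝y (F , (P , below , comparable) , |F|≡k) =
    F , (insert y P , below′ , λ _ _ y∈F z∈F → comparable-⊆ (⊆-insert y P) (comparable _ _ y∈F z∈F))
      , |F|≡k
    where
    below′ : ∀ z → z ∈ proj₁ F → Path (proj₁ (insert y P)) z y
    below′ z z∈F = path-∷ʳ (path-⊆ (⊆-insert y P) (below z z∈F)) x⇝y (∈-insert y P)

  -- The new top y is not already in the chain, since it would then lie on a strict cycle.
  chain-⋖ : Acyclic → ∀ {x y k} → x ⋖ y → HasChainOfLength x k → HasChainOfLength y (suc k)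
  chain-⋖ acyclic {x} {y} x⋖y ((F , F-unique) , (P , below , comparable) , |F|≡k) =
    (y ∷ F , ¬Any⇒All¬ F y∉F ∷ F-unique) , (P′ , below′ , comparable′) , cong suc |F|≡k
    where
    P′ = insert y P
    y∈P′ = ∈-insert y P
    P⊆P′ = ⊆-insert y P
    z→y : ∀ z → z ∈ F → StrictPath (proj₁ P′) z y
    z→y z z∈F = x , y , path-⊆ P⊆P′ (below z z∈F) , x⋖y , [] y∈P′
    y∉F : y ∉ F
    y∉F y∈F = acyclic (P′ , y , z→y y y∈F)
    below′ : ∀ z → z ∈ y ∷ F → Path (proj₁ P′) z y
    below′ z (here refl) = [] y∈P′
    below′ z (there z∈F) = path-∷ʳ (path-⊆ P⊆P′ (below z z∈F)) (inj₁ x⋖y) y∈P′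
    comparable′ : ∀ z w → z ∈ y ∷ F → w ∈ y ∷ F → Comparable (proj₁ P′) z w
    comparable′ z w (here refl) (here refl) = inj₂ (inj₂ refl)
    comparable′ z w (here refl) (there w∈F) = inj₂ (inj₁ (z→y w w∈F))
    comparable′ z w (there z∈F) (here refl) = inj₁ (z→y z z∈F)
    comparable′ z w (there z∈F) (there w∈F) = comparable-⊆ P⊆P′ (comparable z w z∈F w∈F)

  module _ (acyclic : Acyclic) (bounded : ChainsBounded) where

    private
      longestChain : ∀ x → Σ[ m ∈ ℕ ] HasChainOfLength x m × (∀ k → HasChainOfLength x k → k ≤ m)
      longestChain x = bounded⇒∃max (HasChainOfLength x) (emptyChain x) (proj₁ (bounded x))
        (λ k (F , chain , |F|≡k) → subst (_≤ proj₁ (bounded x)) |F|≡k (proj₂ (bounded x) F chain))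

    rank : C → ℕ
    rank x = proj₁ (longestChain x)

    rank-⇝ : ∀ {x y} → x ⇝ y → rank x ≤ rank y
    rank-⇝ {x} {y} x⇝y =
      proj₂ (proj₂ (longestChain y)) (rank x) (chain-⇝ x⇝y (proj₁ (proj₂ (longestChain x))))

    rank-⋖ : ∀ {x y} → x ⋖ y → rank x < rank y
    rank-⋖ {x} {y} x⋖y =
      proj₂ (proj₂ (longestChain y)) (suc (rank x)) (chain-⋖ acyclic x⋖y (proj₁ (proj₂ (longestChain x))))

    rank-hom : 𝓑 ⪯ℕ
    rank-hom = rank
             , (λ p _ _ r → rank-⋖ (p , r))
             , (λ p _ _ r → ≤-antisym (rank-⇝ (inj₂ (inj₁ (p , r)))) (rank-⇝ (inj₂ (inj₂ (p , r)))))

module Formulas {σ : Sig} where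

  falsum : ∀ {n m} → Formula σ n m
  falsum = ex₂ (ex₁ (and (mem zero zero) (neg (mem zero zero))))

  or imp : ∀ {n m} → Formula σ n m → Formula σ n m → Formula σ n m
  or  φ ψ = neg (and (neg φ) (neg ψ))
  imp φ ψ = neg (and φ (neg ψ))

  all₁ : ∀ {n m} → Formula σ (suc n) m → Formula σ n m
  all₁ φ = neg (ex₁ (neg φ))

  all₂ : ∀ {n m} → Formula σ n (suc m) → Formula σ n m
  all₂ φ = neg (ex₂ (neg φ))

  -- A symbol outside σ is read as the empty relation.
  atom? : ∀ {n m} → Sym → Fin n → Fin n → Formula σ n m
  atom? s i j with T? (σ s)
  ... | yes p = atom s p i j
  ... | no _  = falsum

  edge : ∀ {n m} → Fin n → Fin n → Formula σ n m
  edge i j = or (atom? lt i j) (or (atom? eq i j) (atom? eq j i))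

  closed : ∀ {n m} → Fin m → Fin m → Formula σ n m
  closed Z P = all₁ (all₁ (imp (mem (suc zero) Z) (imp (mem zero P) (imp (edge (suc zero) zero) (mem zero Z)))))

  reach : ∀ {n m} → Fin m → Fin n → Fin n → Formula σ n m
  reach P a b = and (mem a P) (all₂ (imp (mem a zero) (imp (closed zero (suc P)) (mem b zero))))

  strictReach : ∀ {n m} → Fin m → Fin n → Fin n → Formula σ n m
  strictReach P a b = ex₁ (ex₁
    (and (reach P (suc (suc a)) (suc zero)) (and (atom? lt (suc zero) zero) (reach P zero (suc (suc b))))))

  same : ∀ {n m} → Fin n → Fin n → Formula σ n m
  same a b = all₂ (imp (mem a zero) (mem b zero))

  comparable : ∀ {n m} → Fin m → Fin n → Fin n → Formula σ n m
  comparable P a b = or (strictReach P a b) (or (strictReach P b a) (same a b))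

  -- Free variable x and free set F; the bound set P is the support of the paths.
  chainBelow : Formula σ 1 1
  chainBelow = ex₂ (and
    (all₁ (imp (mem zero (suc zero)) (reach zero zero (suc zero))))
    (all₁ (all₁ (imp (mem (suc zero) (suc zero)) (imp (mem zero (suc zero)) (comparable zero (suc zero) zero))))))

  homℕ-sentence : Sentence σ
  homℕ-sentence = and (neg (ex₂ (ex₁ (strictReach zero zero zero)))) (all₁ (bnd chainBelow))

module Semantics (lem : ExcludedMiddle 0ℓ) {σ : Sig} (𝓑 : Structure σ) where

  open Classical lem
  open Graph 𝓑
  open Formulas {σ}

  private
    C : Set
    C = Carrier 𝓑

  -- The least closed set containing a, taken as the witness, is the set of vertices reachable from a.
  closure⇒path : ∀ (P : FinSet C) {a b} → a ∈ proj₁ P →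
    (∀ (Z : FinSet C) → a ∈ proj₁ Z → Closed (proj₁ Z) (proj₁ P) → b ∈ proj₁ Z) → Path (proj₁ P) a b
  closure⇒path (P , P-unique) {a} a∈P least =
    proj₂ (∈-filter⁻ reachable? {xs = P} (least Z a∈Z Z-closed))
    where
    reachable? : (c : C) → Dec (Path P a c)
    reachable? _ = lem
    Z : FinSet C
    Z = filter reachable? P , filter⁺ reachable? P-unique
    a∈Z : a ∈ proj₁ Z
    a∈Z = ∈-filter⁺ reachable? a∈P ([] a∈P)
    Z-closed : Closed (proj₁ Z) P
    Z-closed u v u∈Z v∈P u⇝v =
      ∈-filter⁺ reachable? v∈P (path-∷ʳ (proj₂ (∈-filter⁻ reachable? {xs = P} u∈Z)) u⇝v v∈P)

  indiscernible⇔≡ : ∀ {a b : C} → (∀ (Z : FinSet C) → a ∈ proj₁ Z → b ∈ proj₁ Z) ⇔ (a ≡ b)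
  indiscernible⇔≡ {a} =
    mk⇔ (λ a∈⇒b∈ → b≡a⇒a≡b (a∈⇒b∈ (a ∷ [] , All.[] ∷ []) (here refl))) λ { refl _ a∈Z → a∈Z }
    where
    b≡a⇒a≡b : ∀ {b} → b ∈ a ∷ [] → a ≡ b
    b≡a⇒a≡b (here b≡a) = sym b≡a

  sat-falsum : ∀ {n m} ρ ξ → ¬ Sat 𝓑 (falsum {n = n} {m}) ρ ξ
  sat-falsum ρ ξ (_ , _ , x∈X , x∉X) = x∉X x∈X

  sat-atom? : ∀ {n m} ρ ξ s (i j : Fin n) →
    Sat 𝓑 (atom? {m = m} s i j) ρ ξ ⇔ (Σ[ p ∈ T (σ s) ] rel 𝓑 s p (ρ i) (ρ j))
  sat-atom? ρ ξ s i j with T? (σ s)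
  ... | yes p = mk⇔ (p ,_) (λ (q , r) → subst (λ q → rel 𝓑 s q (ρ i) (ρ j)) (T-irrelevant q p) r)
  ... | no ¬p = mk⇔ (⊥-elim ∘ sat-falsum ρ ξ) (⊥-elim ∘ ¬p ∘ proj₁)

  sat-edge : ∀ {n m} ρ ξ (i j : Fin n) → Sat 𝓑 (edge {m = m} i j) ρ ξ ⇔ (ρ i ⇝ ρ j)
  sat-edge ρ ξ i j =
    ¬×¬-cong-⊎ (sat-atom? ρ ξ lt i j) (¬×¬-cong-⊎ (sat-atom? ρ ξ eq i j) (sat-atom? ρ ξ eq j i))

  sat-closed : ∀ {n m} ρ ξ (Z P : Fin m) →
    Sat 𝓑 (closed {n = n} Z P) ρ ξ ⇔ Closed (proj₁ (ξ Z)) (proj₁ (ξ P))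
  sat-closed ρ ξ Z P = ¬∃¬-cong-∀ λ u → ¬∃¬-cong-∀ λ v →
    ¬×¬-cong-→ (⇔-id _) (¬×¬-cong-→ (⇔-id _)
      (¬×¬-cong-→ (sat-edge (v ▸ (u ▸ ρ)) ξ (suc zero) zero) (⇔-id _)))

  sat-reach : ∀ {n m} ρ ξ (P : Fin m) (a b : Fin n) →
    Sat 𝓑 (reach P a b) ρ ξ ⇔ Path (proj₁ (ξ P)) (ρ a) (ρ b)
  sat-reach ρ ξ P a b =
    (⇔-id _ ×-⇔ ¬∃¬-cong-∀ λ Z →
       ¬×¬-cong-→ (⇔-id _) (¬×¬-cong-→ (sat-closed ρ (Z ▸ ξ) zero (suc P)) (⇔-id _)))
    ⟨⇔⟩ mk⇔ (λ (a∈P , least) → closure⇒path (ξ P) a∈P least)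
            (λ path → path-head path , λ Z a∈Z Z-closed → path⇒∈closed (proj₁ Z) path a∈Z Z-closed)

  sat-strictReach : ∀ {n m} ρ ξ (P : Fin m) (a b : Fin n) →
    Sat 𝓑 (strictReach P a b) ρ ξ ⇔ StrictPath (proj₁ (ξ P)) (ρ a) (ρ b)
  sat-strictReach ρ ξ P a b = ∃-cong-⇔ λ u → ∃-cong-⇔ λ v →
    let ρ′ = v ▸ (u ▸ ρ) in
    sat-reach ρ′ ξ P (suc (suc a)) (suc zero)
      ×-⇔ (sat-atom? ρ′ ξ lt (suc zero) zero ×-⇔ sat-reach ρ′ ξ P zero (suc (suc b)))

  sat-same : ∀ {n m} ρ ξ (a b : Fin n) → Sat 𝓑 (same {m = m} a b) ρ ξ ⇔ (ρ a ≡ ρ b)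
  sat-same ρ ξ a b = ¬∃¬-cong-∀ (λ Z → ¬×¬-cong-→ (⇔-id _) (⇔-id _)) ⟨⇔⟩ indiscernible⇔≡

  sat-comparable : ∀ {n m} ρ ξ (P : Fin m) (a b : Fin n) →
    Sat 𝓑 (comparable P a b) ρ ξ ⇔ Comparable (proj₁ (ξ P)) (ρ a) (ρ b)
  sat-comparable ρ ξ P a b =
    ¬×¬-cong-⊎ (sat-strictReach ρ ξ P a b) (¬×¬-cong-⊎ (sat-strictReach ρ ξ P b a) (sat-same ρ ξ a b))

  sat-chainBelow : ∀ ρ ξ → Sat 𝓑 chainBelow ρ ξ ⇔ ChainBelow (ρ zero) (proj₁ (ξ zero))
  sat-chainBelow ρ ξ = ∃-cong-⇔ λ P →
    (¬∃¬-cong-∀ λ y → ¬×¬-cong-→ (⇔-id _) (sat-reach (y ▸ ρ) (P ▸ ξ) zero zero (suc zero)))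
    ×-⇔ (¬∃¬-cong-∀ λ y → ¬∃¬-cong-∀ λ z →
          ¬×¬-cong-→ (⇔-id _) (¬×¬-cong-→ (⇔-id _)
            (sat-comparable (z ▸ (y ▸ ρ)) (P ▸ ξ) zero (suc zero) zero)))

  sat-homℕ-sentence : (𝓑 ⊨ homℕ-sentence) ⇔ (Acyclic × ChainsBounded)
  sat-homℕ-sentence =
    ¬-cong-⇔ (∃-cong-⇔ λ P → ∃-cong-⇔ λ y → sat-strictReach (y ▸ (λ ())) (P ▸ (λ ())) zero zero zero)
    ×-⇔ (¬∃¬-cong-∀ λ x → ∃-cong-⇔ λ b → ∀-cong-⇔ λ F →
          →-cong-⇔ (sat-chainBelow (x ▸ (λ ())) (F ▸ (λ ()))) (⇔-id _))

reverseLt : ∀ {σ n m} → Formula σ n m → Formula σ n m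
reverseLt (atom lt p i j) = atom lt p j i
reverseLt (atom eq p i j) = atom eq p i j
reverseLt (mem i X)       = mem i X
reverseLt (neg φ)         = neg (reverseLt φ)
reverseLt (and φ ψ)       = and (reverseLt φ) (reverseLt ψ)
reverseLt (ex₁ φ)         = ex₁ (reverseLt φ)
reverseLt (ex₂ φ)         = ex₂ (reverseLt φ)
reverseLt (bnd φ)         = bnd (reverseLt φ)

_ᵒᵖ : ∀ {σ} → Structure σ → Structure σ
𝓑 ᵒᵖ = record
  { Carrier = Carrier 𝓑
  ; enc     = enc 𝓑
  ; enc-inj = enc-inj 𝓑
  ; rel     = λ { lt p x y → rel 𝓑 lt p y x ; eq p x y → rel 𝓑 eq p x y }
  }

sat-reverseLt : ∀ {σ n m} (𝓑 : Structure σ) (φ : Formula σ n m) ρ ξ →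
  Sat 𝓑 (reverseLt φ) ρ ξ ⇔ Sat (𝓑 ᵒᵖ) φ ρ ξ
sat-reverseLt 𝓑 (atom lt p i j) ρ ξ = ⇔-id _
sat-reverseLt 𝓑 (atom eq p i j) ρ ξ = ⇔-id _
sat-reverseLt 𝓑 (mem i X)       ρ ξ = ⇔-id _
sat-reverseLt 𝓑 (neg φ)         ρ ξ = ¬-cong-⇔ (sat-reverseLt 𝓑 φ ρ ξ)
sat-reverseLt 𝓑 (and φ ψ)       ρ ξ = sat-reverseLt 𝓑 φ ρ ξ ×-⇔ sat-reverseLt 𝓑 ψ ρ ξ
sat-reverseLt 𝓑 (ex₁ φ)         ρ ξ = ∃-cong-⇔ λ b → sat-reverseLt 𝓑 φ (b ▸ ρ) ξ
sat-reverseLt 𝓑 (ex₂ φ)         ρ ξ = ∃-cong-⇔ λ F → sat-reverseLt 𝓑 φ ρ (F ▸ ξ)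
sat-reverseLt 𝓑 (bnd φ)         ρ ξ =
  ∃-cong-⇔ λ b → ∀-cong-⇔ λ F → →-cong-⇔ (sat-reverseLt 𝓑 φ ρ (F ▸ ξ)) (⇔-id _)

negIndex : Neg → ℕ
negIndex (-[1+ n ] , _)  = n
negIndex (+ _ , +<+ ())

negIndex-< : ∀ a b → proj₁ a ℤ.< proj₁ b → negIndex b < negIndex a
negIndex-< (-[1+ _ ] , _) (-[1+ _ ] , _) (-<- n<m) = n<m
negIndex-< (-[1+ _ ] , _) (+ _ , +<+ ())  _
negIndex-< (+ _ , +<+ ()) _               _

negIndex-≡ : ∀ a b → proj₁ a ≡ proj₁ b → negIndex a ≡ negIndex b
negIndex-≡ (-[1+ _ ] , _) (-[1+ _ ] , _) m≡n = -[1+-injective m≡n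
negIndex-≡ (-[1+ _ ] , _) (+ _ , +<+ ())  _
negIndex-≡ (+ _ , +<+ ()) _               _

⪯Neg⇔ᵒᵖ⪯ℕ : ∀ {σ} (𝓑 : Structure σ) → (𝓑 ⪯Neg) ⇔ ((𝓑 ᵒᵖ) ⪯ℕ)
⪯Neg⇔ᵒᵖ⪯ℕ 𝓑 = mk⇔
  (λ (h , h-< , h-≡) → negIndex ∘ h
    , (λ p x y r → negIndex-< (h y) (h x) (h-< p y x r))
    , (λ p x y r → negIndex-≡ (h x) (h y) (h-≡ p x y r)))
  (λ (g , g-< , g-≡) → (λ x → -[1+ g x ] , -<+)
    , (λ p x y r → -<- (g-< p y x r))
    , (λ p x y r → cong -[1+_] (g-≡ p x y r)))

open Formulas using (homℕ-sentence)

⪯ℕ⇔⊨homℕ-sentence : ExcludedMiddle 0ℓ → ∀ {σ} (𝓑 : Structure σ) → (𝓑 ⪯ℕ) ⇔ (𝓑 ⊨ homℕ-sentence)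
⪯ℕ⇔⊨homℕ-sentence lem 𝓑 =
  mk⇔ (λ hom → ⪯ℕ⇒acyclic hom , ⪯ℕ⇒chainsBounded hom)
      (λ (acyclic , bounded) → rank-hom acyclic bounded)
  ⟨⇔⟩ ⇔-sym sat-homℕ-sentence
  where
  open Graph 𝓑
  open Rank lem 𝓑
  open Semantics lem 𝓑

proposition4 : EHomDef-WMSOB _⪯ℕ × EHomDef-WMSOB _⪯Neg
proposition4 =
    ((λ σ → homℕ-sentence) , λ lem σ 𝓑 → ⪯ℕ⇔⊨homℕ-sentence lem 𝓑)
  , ((λ σ → reverseLt homℕ-sentence) , λ lem σ 𝓑 →
       ⪯Neg⇔ᵒᵖ⪯ℕ 𝓑
       ⟨⇔⟩ ⪯ℕ⇔⊨homℕ-sentence lem (𝓑 ᵒᵖ)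
       ⟨⇔⟩ ⇔-sym (sat-reverseLt 𝓑 homℕ-sentence (λ ()) (λ ())))
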